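{- Fix any collect algorithm $A$ and an execution of it. Let $(t_1,t_2]$ be any time interval, and suppose exactly $m$ processes carry out at least one step during $(t_1,t_2]$. Then $$\sum_p M_p(t_2)-\sum_p M_p(t_1)\ge \binom m2.$$
   Context: Model: $n$ processes communicate through atomic single-writer multi-reader registers, one owned by each process; an execution is an interleaved sequence of steps (each a read or write of one register) ordered by an adversarial schedule. Time is measured by the total number of steps taken by all processes. Each process repeatedly performs collect operations (each a sequence of reads and writes by which the process obtains values of all $n$ registers), starting a new one as soon as the previous finishes. A step $\pi$ by a process $q$ is useful for $p$ if $\pi$ is part of a collect that started before $p$'s current collect. A step $\pi$ by a process $q$ is extraneous for $p$ if $\pi$ occurs during an interval where $p$ has finished one collect but has not yet taken any step of a new collect, and $\pi$ is either the first or the last operation of $q$ in this interval. $M_p(t)$ is the total number of steps that are useful or extraneous for $p$ among the first $t$ steps of the execution.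
   Formalization: For extraneous steps, the period before p takes its first step also counts as an interval where p has finished one collect but has not yet taken any step of a new collect. The statement above fails without it. -}

module Defs where

open import Data.Nat using (ℕ; zero; suc; _≤_; _<_)
open import Data.Fin using (Fin)
open import Data.Bool using (Bool; true)
open import Data.Maybe using (Maybe; just; nothing)
import Data.Maybe as Maybe
open import Data.Product using (Σ; _×_)
open import Data.Sum using (_⊎_)
open import Relation.Binary.PropositionalEquality using (_≡_)
open import Relation.Nullary using (¬_)

-- An operation on the shared memory: a read of some register, or a
-- write of the process's own register.
data Op (n : ℕ) : Set where
  read  : Fin n → Op n
  write : Op n

-- A step: the process taking it, the operation, and whether this step
-- is the last step of the collect it belongs to (i.e. the collect
-- finishes with this step).
record Step (n : ℕ) : Set where
  constructor mkStep
  field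
    proc : Fin n
    op   : Op n
    ends : Bool

open Step public

-- An execution: E i is the (i+1)-th step of the execution (time i+1), or
-- nothing if the execution has already ended (finite executions).
Execution : ℕ → Set
Execution n = ℕ → Maybe (Step n)

WellFormed : ∀ {n} → Execution n → Set
WellFormed E = ∀ i → E i ≡ nothing → E (suc i) ≡ nothing

module _ {n : ℕ} (E : Execution n) where

  StepBy : Fin n → ℕ → Set
  StepBy q i = Maybe.map proc (E i) ≡ just q

  EndBy : Fin n → ℕ → Set
  EndBy q i = Σ (Step n) λ s → E i ≡ just s × proc s ≡ q × ends s ≡ true

  -- j is the index of the first step of the collect containing q's step i
  -- (collects of q are the maximal blocks of q's consecutive steps ending
  --  in an EndBy step; a collect starts at its first step)
  CollectStartOf : Fin n → ℕ → ℕ → Set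
  CollectStartOf q i j =
    StepBy q i × j ≤ i × StepBy q j
    × (∀ k → j ≤ k → k < i → ¬ EndBy q k)
    × (∀ k → k < j → StepBy q k → Σ ℕ λ k' → k ≤ k' × k' < j × EndBy q k')

  LastStepBefore : Fin n → ℕ → ℕ → Set
  LastStepBefore p i j = j < i × StepBy p j × (∀ k → j < k → k < i → ¬ StepBy p k)

  InCollectAt : Fin n → ℕ → ℕ → Set
  InCollectAt p i s = Σ ℕ λ j → LastStepBefore p i j × ¬ EndBy p j × CollectStartOf p j s

  InGapAt : Fin n → ℕ → Set
  InGapAt p i = (∀ k → k < i → ¬ StepBy p k)
              ⊎ (Σ ℕ λ j → LastStepBefore p i j × EndBy p j)

  Useful : Fin n → ℕ → Set
  Useful p i = Σ (Fin n) λ q → Σ ℕ λ sq → Σ ℕ λ sp →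
    CollectStartOf q i sq × InCollectAt p i sp × sq < sp

  -- step i is extraneous for p: it occurs (as a step of q ≠ p) during a
  -- gap of p, and is the first or the last step of q in that gap
  Extraneous : Fin n → ℕ → Set
  Extraneous p i = Σ (Fin n) λ q → StepBy q i × InGapAt p i × ¬ StepBy p i ×
    ( (∀ k → k < i → StepBy q k → Σ ℕ λ l → k ≤ l × l < i × StepBy p l)
    ⊎ (∀ k → i < k → StepBy q k → Σ ℕ λ l → i < l × l < k × StepBy p l))

  UsefulOrExtraneous : Fin n → ℕ → Set
  UsefulOrExtraneous p i = Useful p i ⊎ Extraneous p i

  -- p takes at least one step during (t₁, t₂], i.e. among indices t₁ .. t₂-1
  Active : ℕ → ℕ → Fin n → Set
  Active t₁ t₂ p = Σ ℕ λ i → t₁ ≤ i × i < t₂ × StepBy p i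

data Count (P : ℕ → Set) : ℕ → ℕ → Set where
  cz  : Count P zero zero
  cyes : ∀ {i k} → P i → Count P i k → Count P (suc i) (suc k)
  cno  : ∀ {i k} → ¬ P i → Count P i k → Count P (suc i) k

M : ∀ {n} → Execution n → Fin n → ℕ → ℕ → Set
M E p t k = Count (UsefulOrExtraneous E p) t k

-- Let p ≠ q both be active in the window and let a < b be their first steps there, p's first.
-- If q is between collects at a, the last step of p before b is extraneous for q.  Otherwise
-- q is inside a collect begun before a; if p is between collects at b, step b (q's first in
-- that gap of p) is extraneous for p, and if p too is inside a collect, the step (b, resp. a)
-- of the process whose current collect began earlier is useful for the other one.  So every
-- pair of active processes yields a window step taken by one of them and counted by the
-- other.  A step has a single owner, so the steps p counts for different partners are
-- distinct, and summing over p gives the C(m,2) bound.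
module Submission where

open import Defs
open import Data.Nat using (ℕ; _≤_; _+_)
open import Data.Nat.Combinatorics using (_C_)
open import Data.Fin using (Fin)
open import Data.Fin.Subset using (Subset; _∈_; ∣_∣)
open import Data.List using (map)
open import Data.Nat.ListAction using (sum)
open import Data.List.Base using (allFin)
open import Function.Bundles using (_⇔_)
open import Relation.Binary.PropositionalEquality using (_≡_)

open import Data.Nat.Properties
open import Algebra.Properties.CommutativeMonoid.Sum +-0-commutativeMonoid
  using (sum-syntax; sum-cong-≗; sum-replicate-zero; ∑-distrib-+)
open import Data.Bool using (true; false)
import Data.Bool as Bool
open import Data.Empty using (⊥-elim)
open import Data.Fin using (zero; suc)
import Data.Fin as Fin
import Data.Fin.Properties as Fin
open import Data.Fin.Subset.Properties using (_∈?_)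
open import Data.List using (tabulate)
open import Data.List.Properties using (map-tabulate)
open import Data.Maybe using (Maybe; just; nothing; _>>=_; _<∣>_)
import Data.Maybe as Maybe
open import Data.Maybe.Properties using (just-injective)
open import Data.Nat using (zero; suc; _<_; z≤n; _≟_; _≤?_; _<?_)
open import Data.Nat.Combinatorics using (nCk+nC[k+1]≡[n+1]C[k+1]; nC1≡n)
open import Data.Nat.Induction using (<-rec)
open import Data.Product using (Σ; ∃; _×_; _,_; proj₁)
open import Data.Sum using (_⊎_; inj₁; inj₂; [_,_]′; swap)
open import Data.Vec using ([]; _∷_; here; there)
open import Function using (_∘_; _∘₂_; id; const)
open import Function.Bundles using (Equivalence)
open import Relation.Binary.Definitions using (tri<; tri≈; tri>)
open import Relation.Binary.PropositionalEquality
open import Relation.Nullary using (¬_; Dec; yes; no)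
open import Relation.Nullary.Decidable using (map′; dec-yes; dec⇒maybe; _×-dec_; ¬?)
open import Relation.Unary using (Decidable)

sum-map-allFin : ∀ n (f : Fin n → ℕ) → sum (map f (allFin n)) ≡ ∑[ i < n ] f i
sum-map-allFin n f = trans (cong sum (map-tabulate id f)) (sum-tabulate f)
  where
  sum-tabulate : ∀ {n} (f : Fin n → ℕ) → sum (tabulate f) ≡ ∑[ i < n ] f i
  sum-tabulate {zero}  f = refl
  sum-tabulate {suc n} f = cong (f zero +_) (sum-tabulate (f ∘ suc))

∑-mono-≤ : ∀ {n} {f g : Fin n → ℕ} → (∀ i → f i ≤ g i) → ∑[ i < n ] f i ≤ ∑[ i < n ] g i
∑-mono-≤ {zero}  _   = z≤n
∑-mono-≤ {suc n} f≤g = +-mono-≤ (f≤g zero) (∑-mono-≤ (f≤g ∘ suc))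

∣S∣≤∑ : ∀ {n} (S : Subset n) {f : Fin n → ℕ} → (∀ i → i ∈ S → 1 ≤ f i) → ∣ S ∣ ≤ ∑[ i < n ] f i
∣S∣≤∑ []          _   = z≤n
∣S∣≤∑ (true ∷ S)  pos = +-mono-≤ (pos zero here) (∣S∣≤∑ S (λ i → pos (suc i) ∘ there))
∣S∣≤∑ (false ∷ S) {f} pos = ≤-trans (∣S∣≤∑ S (λ i → pos (suc i) ∘ there)) (m≤n+m _ (f zero))

Covers : ∀ {n} → Subset n → (Fin n → Fin n → ℕ) → Set
Covers S x = ∀ p q → p ∈ S → q ∈ S → p ≢ q → 1 ≤ x p q + x q p

Covers-tail : ∀ {n b} {S : Subset n} (x : Fin (suc n) → Fin (suc n) → ℕ) →
  Covers (b ∷ S) x → Covers S (λ p q → x (suc p) (suc q))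
Covers-tail x covers p q p∈S q∈S p≢q =
  covers (suc p) (suc q) (there p∈S) (there q∈S) (λ 1+p≡1+q → p≢q (Fin.suc-injective 1+p≡1+q))

[1+n]C2≡n+nC2 : ∀ n → suc n C 2 ≡ n + n C 2
[1+n]C2≡n+nC2 n = trans (sym (nCk+nC[k+1]≡[n+1]C[k+1] n 1)) (cong (_+ n C 2) (nC1≡n n))

cross : ∀ {n} → (Fin (suc n) → Fin (suc n) → ℕ) → Fin n → ℕ
cross x q = x zero (suc q) + x (suc q) zero

∑∑-peel : ∀ {n} (x : Fin (suc n) → Fin (suc n) → ℕ) →
  ∑[ p < suc n ] ∑[ q < suc n ] x p q
    ≡ x zero zero + ∑[ q < n ] cross x q + ∑[ p < n ] ∑[ q < n ] x (suc p) (suc q)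
∑∑-peel {n} x = begin
  x₀₀ + A + ∑[ p < n ] (x (suc p) zero + ∑[ q < n ] x (suc p) (suc q))
                         ≡⟨ cong (x₀₀ + A +_) (∑-distrib-+ (λ p → x (suc p) zero) D-row) ⟩
  x₀₀ + A + (B + D)      ≡⟨ +-assoc x₀₀ A (B + D) ⟩
  x₀₀ + (A + (B + D))    ≡⟨ cong (x₀₀ +_) (sym (+-assoc A B D)) ⟩
  x₀₀ + (A + B + D)      ≡⟨ sym (+-assoc x₀₀ (A + B) D) ⟩
  x₀₀ + (A + B) + D
                         ≡⟨ cong (λ AB → x₀₀ + AB + D) (sym (∑-distrib-+ (λ q → x zero (suc q)) (λ q → x (suc q) zero))) ⟩
  x₀₀ + ∑[ q < n ] cross x q + D ∎
  where
  open ≡-Reasoning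
  D-row : Fin n → ℕ
  D-row p = ∑[ q < n ] x (suc p) (suc q)
  x₀₀ A B D : ℕ
  x₀₀ = x zero zero
  A = ∑[ q < n ] x zero (suc q)
  B = ∑[ p < n ] x (suc p) zero
  D = ∑[ p < n ] D-row p

∣S∣C2≤∑∑ : ∀ {n} (S : Subset n) (x : Fin n → Fin n → ℕ) → Covers S x →
  ∣ S ∣ C 2 ≤ ∑[ p < n ] ∑[ q < n ] x p q
∣S∣C2≤∑∑ []                  x _      = z≤n
∣S∣C2≤∑∑ {suc n} (b ∷ S) x covers = begin
  ∣ b ∷ S ∣ C 2                        ≤⟨ new-pairs b covers ⟩
  ∑[ q < n ] cross x q + D             ≤⟨ +-monoˡ-≤ D (m≤n+m (∑[ q < n ] cross x q) (x zero zero)) ⟩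
  x zero zero + ∑[ q < n ] cross x q + D ≡⟨ sym (∑∑-peel x) ⟩
  ∑[ p < suc n ] ∑[ q < suc n ] x p q  ∎
  where
  open ≤-Reasoning
  D : ℕ
  D = ∑[ p < n ] ∑[ q < n ] x (suc p) (suc q)
  old-pairs : ∣ S ∣ C 2 ≤ D
  old-pairs = ∣S∣C2≤∑∑ S (λ p q → x (suc p) (suc q)) (Covers-tail x covers)
  new-pairs : ∀ b → Covers (b ∷ S) x → ∣ b ∷ S ∣ C 2 ≤ ∑[ q < n ] cross x q + D
  new-pairs false _      = ≤-trans old-pairs (m≤n+m D _)
  new-pairs true  covers = begin
    suc ∣ S ∣ C 2              ≡⟨ [1+n]C2≡n+nC2 ∣ S ∣ ⟩
    ∣ S ∣ + ∣ S ∣ C 2          ≤⟨ +-mono-≤ (∣S∣≤∑ S λ q q∈S → covers zero (suc q) here (there q∈S) λ ())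
                                             old-pairs ⟩
    ∑[ q < n ] cross x q + D   ∎

size : ∀ {a} {A : Set a} → Maybe A → ℕ
size (just _) = 1
size nothing  = 0

size-<∣>ʳ : ∀ {a} {A : Set a} (x y : Maybe A) → size y ≤ size (x <∣> y)
size-<∣>ʳ (just _) (just _) = ≤-refl
size-<∣>ʳ (just _) nothing  = z≤n
size-<∣>ʳ nothing  _        = ≤-refl

size-map : ∀ {a b} {A : Set a} {B : Set b} (f : A → B) (x : Maybe A) → size (Maybe.map f x) ≡ size x
size-map f (just _) = refl
size-map f nothing  = refl

module Orientation {A : Set} (R : A → A → Set) {C : A → A → Set} (C? : ∀ p q → Dec (C p q))
                   (compare : ∀ {p q} → C p q → R p q ⊎ R q p) where

  compared : ∀ p q → Maybe (R p q ⊎ R q p)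
  compared p q = Maybe.map compare (dec⇒maybe (C? p q))

  oriented : ∀ p q → Maybe (R p q)
  oriented p q = (compared p q >>= [ just , const nothing ]′) <∣> (compared q p >>= [ const nothing , just ]′)

  oriented-covers : ∀ {p q} → C p q → 1 ≤ size (oriented p q) + size (oriented q p)
  oriented-covers {p} {q} c with dec-yes (C? p q) c
  ... | c′ , C?≡yes rewrite C?≡yes with compare c′
  ... | inj₁ r = m≤m+n 1 _
  ... | inj₂ r = ≤-trans (size-<∣>ʳ (compared q p >>= [ just , const nothing ]′) (just r)) (m≤n+m _ _)

map-proj₁-just : ∀ {A : Set} {P : A → Set} (x : Maybe (Σ A P)) {a} → Maybe.map proj₁ x ≡ just a → P a
map-proj₁-just (just (_ , Pa)) refl = Pa

Count-functional : ∀ {P t k k′} → Count P t k → Count P t k′ → k ≡ k′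
Count-functional cz          cz          = refl
Count-functional (cyes _ c)  (cyes _ d)  = cong suc (Count-functional c d)
Count-functional (cyes Pi _) (cno ¬Pi _) = ⊥-elim (¬Pi Pi)
Count-functional (cno ¬Pi _) (cyes Pi _) = ⊥-elim (¬Pi Pi)
Count-functional (cno _ c)   (cno _ d)   = Count-functional c d

without : ℕ → Maybe ℕ → Maybe ℕ
without i nothing  = nothing
without i (just j) with j ≟ i
... | yes _ = nothing
... | no  _ = just j

without-just : ∀ {i j} m → without i m ≡ just j → m ≡ just j × j ≢ i
without-just {i} (just j) eq with j ≟ i
without-just (just j) refl | no j≢i = refl , j≢i

without-absent : ∀ {i} m → m ≢ just i → without i m ≡ m
without-absent nothing _ = refl
without-absent {i} (just j) m≢i with j ≟ i
... | yes refl = ⊥-elim (m≢i refl)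
... | no  _    = refl

Distinct : ∀ {n} → (Fin n → Maybe ℕ) → Set
Distinct w = ∀ {q q′ i} → w q ≡ just i → w q′ ≡ just i → q ≡ q′

∑-size-without : ∀ {n} i (w : Fin n → Maybe ℕ) → Distinct w →
  ∑[ q < n ] size (w q) ≤ ∑[ q < n ] size (without i (w q)) + 1
∑-size-without {zero} i w _ = z≤n
∑-size-without {suc n} i w distinct with w zero in w₀
... | nothing = ∑-size-without i (w ∘ suc) (Fin.suc-injective ∘₂ distinct)
... | just j with j ≟ i
...   | no _ = +-monoʳ-≤ 1 (∑-size-without i (w ∘ suc) (Fin.suc-injective ∘₂ distinct))
...   | yes refl = ≤-reflexive (trans (+-comm 1 _) (cong (_+ 1) rest))
  where
  rest : ∑[ q < n ] size (w (suc q)) ≡ ∑[ q < n ] size (without j (w (suc q)))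
  rest = sum-cong-≗ λ q → cong size (sym (without-absent (w (suc q)) λ w[1+q] → 1+q≢0 (distinct w[1+q] w₀)))
    where
    1+q≢0 : ∀ {q : Fin n} → suc q ≢ zero
    1+q≢0 ()

WitnessesIn : ∀ {n} → (ℕ → Set) → ℕ → ℕ → (Fin n → Maybe ℕ) → Set
WitnessesIn P t₁ t w = ∀ q {i} → w q ≡ just i → t₁ ≤ i × i < t × P i

Count-≥-witnesses : ∀ {P t₁ k₁ t k n} → Count P t₁ k₁ → Count P t k → t₁ ≤ t →
  (w : Fin n → Maybe ℕ) → WitnessesIn P t₁ t w → Distinct w → k₁ + ∑[ q < n ] size (w q) ≤ k
Count-≥-witnesses {k₁ = k₁} {n = n} c₁ c t₁≤t w inWindow distinct with m≤n⇒m<n∨m≡n t₁≤t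
... | inj₂ refl = ≤-reflexive (begin
  k₁ + ∑[ q < n ] size (w q)  ≡⟨ cong (k₁ +_) (sum-cong-≗ none) ⟩
  k₁ + ∑[ q < n ] 0           ≡⟨ cong (k₁ +_) (sum-replicate-zero n) ⟩
  k₁ + 0                      ≡⟨ +-identityʳ k₁ ⟩
  k₁                          ≡⟨ Count-functional c₁ c ⟩
  _                           ∎)
  where
  open ≡-Reasoning
  none : ∀ q → size (w q) ≡ 0
  none q with w q in eq
  ... | nothing = refl
  ... | just i with inWindow q eq
  ...   | t₁≤i , i<t₁ , _ = ⊥-elim (<-irrefl refl (≤-<-trans t₁≤i i<t₁))
Count-≥-witnesses {P} {t₁} c₁ (cno {i} ¬Pi c) _ w inWindow distinct | inj₁ t₁<1+i =
  Count-≥-witnesses c₁ c (≤-pred t₁<1+i) w inWindow′ distinct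
  where
  inWindow′ : WitnessesIn P t₁ i w
  inWindow′ q eq with inWindow q eq
  ... | t₁≤j , j<1+i , Pj = t₁≤j , ≤∧≢⇒< (≤-pred j<1+i) (λ { refl → ¬Pi Pj }) , Pj
Count-≥-witnesses {P} {t₁} {k₁} {n = n} c₁ (cyes {i} {k} _ c) _ w inWindow distinct | inj₁ t₁<1+i = begin
  k₁ + ∑[ q < n ] size (w q)         ≤⟨ +-monoʳ-≤ k₁ (∑-size-without i w distinct) ⟩
  k₁ + (∑[ q < n ] size (w′ q) + 1)  ≡⟨ sym (+-assoc k₁ _ 1) ⟩
  k₁ + ∑[ q < n ] size (w′ q) + 1    ≤⟨ +-monoˡ-≤ 1 (Count-≥-witnesses c₁ c (≤-pred t₁<1+i) w′ inWindow′ distinct′) ⟩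
  k + 1                              ≡⟨ +-comm k 1 ⟩
  suc k                              ∎
  where
  open ≤-Reasoning
  w′ : Fin n → Maybe ℕ
  w′ q = without i (w q)
  inWindow′ : WitnessesIn P t₁ i w′
  inWindow′ q eq with without-just (w q) eq
  ... | eq′ , j≢i with inWindow q eq′
  ...   | t₁≤j , j<1+i , Pj = t₁≤j , ≤∧≢⇒< (≤-pred j<1+i) j≢i , Pj
  distinct′ : Distinct w′
  distinct′ {q} {q′} eq eq′ = distinct (proj₁ (without-just (w q) eq)) (proj₁ (without-just (w q′) eq′))

module _ {Q : ℕ → Set} (Q? : Decidable Q) where

  LeastUpTo : ℕ → Set
  LeastUpTo i = ∃ λ a → a ≤ i × Q a × (∀ {k} → k < a → ¬ Q k)

  least : ∀ {i} → Q i → LeastUpTo i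
  least {i} = <-rec (λ i → Q i → LeastUpTo i) search i
    where
    search : ∀ i → (∀ {j} → j < i → Q j → LeastUpTo j) → Q i → LeastUpTo i
    search i below Qi with anyUpTo? Q? i
    ... | no ¬earlier = i , ≤-refl , Qi , λ k<i Qk → ¬earlier (_ , k<i , Qk)
    ... | yes (j , j<i , Qj) with below j<i Qj
    ...   | a , a≤j , Qa , minimal = a , ≤-trans a≤j (<⇒≤ j<i) , Qa , minimal

  greatest-below : ∀ {a} b → Q a → a < b →
    ∃ λ c → a ≤ c × c < b × Q c × (∀ {k} → c < k → k < b → ¬ Q k)
  greatest-below (suc b) Qa a<1+b with Q? b
  ... | yes Qb = b , ≤-pred a<1+b , ≤-refl , Qb , λ b<k k<1+b → ⊥-elim (<⇒≱ b<k (≤-pred k<1+b))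
  ... | no ¬Qb with m<1+n⇒m<n∨m≡n a<1+b
  ...   | inj₂ refl = ⊥-elim (¬Qb Qa)
  ...   | inj₁ a<b with greatest-below b Qa a<b
  ...     | c , a≤c , c<b , Qc , maximal = c , a≤c , m<n⇒m<1+n c<b , Qc , maximal′
    where
    maximal′ : ∀ {k} → c < k → k < suc b → ¬ Q k
    maximal′ c<k k<1+b with m<1+n⇒m<n∨m≡n k<1+b
    ... | inj₁ k<b = maximal c<k k<b
    ... | inj₂ refl = ¬Qb

module _ {n : ℕ} (E : Execution n) where

  stepBy? : ∀ q i → Dec (StepBy E q i)
  stepBy? q i with E i
  ... | nothing = no λ ()
  ... | just s  = map′ (cong just) just-injective (proc s Fin.≟ q)

  endBy? : ∀ q i → Dec (EndBy E q i)
  endBy? q i with E i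
  ... | nothing = no λ { (_ , () , _) }
  ... | just s  = map′ (λ (s≡q , ends) → s , refl , s≡q , ends) (λ { (_ , refl , s≡q , ends) → s≡q , ends })
                       (proc s Fin.≟ q ×-dec ends s Bool.≟ true)

  endBy⇒stepBy : ∀ {q i} → EndBy E q i → StepBy E q i
  endBy⇒stepBy (_ , Ei≡s , s≡q , _) rewrite Ei≡s = cong just s≡q

  stepBy-functional : ∀ {p q i} → StepBy E p i → StepBy E q i → p ≡ q
  stepBy-functional p-step q-step = just-injective (trans (sym p-step) q-step)

  NoStepIn : Fin n → ℕ → ℕ → Set
  NoStepIn q i i′ = ∀ k → i ≤ k → k < i′ → ¬ StepBy E q k

  NoStepIn-suc : ∀ {q i} → ¬ StepBy E q i → NoStepIn q i (suc i)
  NoStepIn-suc ¬step k i≤k k<1+i rewrite ≤-antisym i≤k (≤-pred k<1+i) = ¬step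

  NoStepIn-trans : ∀ {q h i i′} → NoStepIn q h i → NoStepIn q i i′ → NoStepIn q h i′
  NoStepIn-trans {i = i} early late k h≤k k<i′ with k <? i
  ... | yes k<i = early k h≤k k<i
  ... | no  k≮i = late k (≮⇒≥ k≮i) k<i′

  NoStepIn-suffix : ∀ {q h i i′} → h ≤ i → NoStepIn q h i′ → NoStepIn q i i′
  NoStepIn-suffix h≤i none k i≤k = none k (≤-trans h≤i i≤k)

  LastStepBefore-suc : ∀ {q i} → StepBy E q i → LastStepBefore E q (suc i) i
  LastStepBefore-suc step = ≤-refl , step , λ k i<k k<1+i → ⊥-elim (<⇒≱ i<k (≤-pred k<1+i))

  LastStepBefore-extend : ∀ {q i i′ j} → LastStepBefore E q i j → i ≤ i′ → NoStepIn q i i′ →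
    LastStepBefore E q i′ j
  LastStepBefore-extend (j<i , step , between) i≤i′ none =
    <-≤-trans j<i i≤i′ , step , NoStepIn-trans between none

  InGapAt-extend : ∀ {q i i′} → InGapAt E q i → i ≤ i′ → NoStepIn q i i′ → InGapAt E q i′
  InGapAt-extend (inj₁ never) _ none =
    inj₁ λ k → NoStepIn-trans (λ k _ → never k) none k z≤n
  InGapAt-extend (inj₂ (j , last , ended)) i≤i′ none = inj₂ (j , LastStepBefore-extend last i≤i′ none , ended)

  InCollectAt-extend : ∀ {q i i′ s} → InCollectAt E q i s → i ≤ i′ → NoStepIn q i i′ →
    InCollectAt E q i′ s
  InCollectAt-extend (j , last , ¬ended , start) i≤i′ none =
    j , LastStepBefore-extend last i≤i′ none , ¬ended , start

  InCollectAt-start< : ∀ {q i s} → InCollectAt E q i s → s < i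
  InCollectAt-start< (j , (j<i , _) , _ , (_ , s≤j , _)) = ≤-<-trans s≤j j<i

  CollectStartOf-gap : ∀ {q i} → StepBy E q i → InGapAt E q i → CollectStartOf E q i i
  CollectStartOf-gap {q} {i} step gap =
    step , ≤-refl , step , (λ k i≤k k<i → ⊥-elim (<⇒≱ k<i i≤k)) , earlier gap
    where
    earlier : InGapAt E q i →
      ∀ k → k < i → StepBy E q k → Σ ℕ λ k′ → k ≤ k′ × k′ < i × EndBy E q k′
    earlier (inj₁ never) k k<i step-k = ⊥-elim (never k k<i step-k)
    earlier (inj₂ (j , (j<i , _ , between) , ended)) k k<i step-k =
      j , ≮⇒≥ (λ j<k → between k j<k k<i step-k) , j<i , ended

  CollectStartOf-collect : ∀ {q i s} → StepBy E q i → InCollectAt E q i s → CollectStartOf E q i s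
  CollectStartOf-collect {q} {i} {s} step (j , (j<i , _ , between) , ¬ended-j , (_ , s≤j , step-s , ¬ended , earlier)) =
    step , ≤-trans s≤j (<⇒≤ j<i) , step-s , ¬ended′ , earlier
    where
    ¬ended′ : ∀ k → s ≤ k → k < i → ¬ EndBy E q k
    ¬ended′ k s≤k k<i with <-cmp k j
    ... | tri< k<j _ _ = ¬ended k s≤k k<j
    ... | tri≈ _ refl _ = ¬ended-j
    ... | tri> _ _ j<k = ¬ended-k
      where ¬ended-k : ¬ EndBy E q k
            ¬ended-k end = between k j<k k<i (endBy⇒stepBy end)

  CollectStartOf-restrict : ∀ {q i s a} → CollectStartOf E q i s → StepBy E q a → s ≤ a → a ≤ i →
    CollectStartOf E q a s
  CollectStartOf-restrict (_ , _ , step-s , ¬ended , earlier) step-a s≤a a≤i =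
    step-a , s≤a , step-s , (λ k s≤k k<a → ¬ended k s≤k (<-≤-trans k<a a≤i)) , earlier

  Phase : Fin n → ℕ → Set
  Phase q i = InGapAt E q i ⊎ ∃ (InCollectAt E q i)

  phase : ∀ q i → Phase q i
  phase q zero = inj₁ (inj₁ λ _ ())
  phase q (suc i) with stepBy? q i
  ... | no ¬step = extend (phase q i)
    where
    extend : Phase q i → Phase q (suc i)
    extend (inj₁ gap)        = inj₁ (InGapAt-extend gap (n≤1+n i) (NoStepIn-suc ¬step))
    extend (inj₂ (s , coll)) = inj₂ (s , InCollectAt-extend coll (n≤1+n i) (NoStepIn-suc ¬step))
  ... | yes step with endBy? q i
  ...   | yes ended = inj₁ (inj₂ (i , LastStepBefore-suc step , ended))
  ...   | no ¬ended = inj₂ (start (phase q i))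
    where
    start : Phase q i → ∃ (InCollectAt E q (suc i))
    start (inj₁ gap)        = i , i , LastStepBefore-suc step , ¬ended , CollectStartOf-gap step gap
    start (inj₂ (s , coll)) = s , i , LastStepBefore-suc step , ¬ended , CollectStartOf-collect step coll

  module Window (t₁ t₂ : ℕ) where

    CountedStep : Fin n → Fin n → Set
    CountedStep p q = Σ ℕ λ i → t₁ ≤ i × i < t₂ × UsefulOrExtraneous E p i × StepBy E q i

    last-step-extraneous : ∀ {p q a b} → p ≢ q → t₁ ≤ a → a < b → b < t₂ →
      StepBy E p a → StepBy E q b → InGapAt E q a → NoStepIn q a b → CountedStep q p
    last-step-extraneous {p} {q} {a} {b} p≢q t₁≤a a<b b<t₂ step-a step-b gap none
      with greatest-below (stepBy? p) b step-a a<b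
    ... | c , a≤c , c<b , step-c , maximal =
      c , ≤-trans t₁≤a a≤c , <-trans c<b b<t₂ ,
      inj₂ (p , step-c , gap-c , (λ q-step → p≢q (stepBy-functional step-c q-step)) , inj₂ q-steps-after) ,
      step-c
      where
      gap-c : InGapAt E q c
      gap-c = InGapAt-extend gap a≤c (λ k a≤k k<c → none k a≤k (<-trans k<c c<b))
      q-steps-after : ∀ k → c < k → StepBy E p k → Σ ℕ λ l → c < l × l < k × StepBy E q l
      q-steps-after k c<k step-k with <-cmp k b
      ... | tri< k<b _ _  = ⊥-elim (maximal c<k k<b step-k)
      ... | tri≈ _ refl _ = ⊥-elim (p≢q (stepBy-functional step-k step-b))
      ... | tri> _ _ b<k  = b , c<b , b<k , step-b

    first-step-extraneous : ∀ {p q a b} → p ≢ q → t₁ ≤ a → a < b → b < t₂ →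
      StepBy E p a → StepBy E q b → InGapAt E p b → NoStepIn q t₁ b → CountedStep p q
    first-step-extraneous {p} {q} {a} {b} p≢q t₁≤a a<b b<t₂ step-a step-b gap none =
      b , ≤-trans t₁≤a (<⇒≤ a<b) , b<t₂ ,
      inj₂ (q , step-b , gap , (λ p-step → p≢q (stepBy-functional p-step step-b)) , inj₁ p-steps-before) ,
      step-b
      where
      p-steps-before : ∀ k → k < b → StepBy E q k → Σ ℕ λ l → k ≤ l × l < b × StepBy E p l
      p-steps-before k k<b step-k with t₁ ≤? k
      ... | yes t₁≤k = ⊥-elim (none k t₁≤k k<b step-k)
      ... | no  t₁≰k = a , ≤-trans (<⇒≤ (≰⇒> t₁≰k)) t₁≤a , a<b , step-a

    earlier-collect-useful : ∀ {p q a b sp sq} → p ≢ q → t₁ ≤ a → a < b → b < t₂ →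
      StepBy E p a → StepBy E q b → InCollectAt E q a sq → InCollectAt E p b sp → NoStepIn q a b →
      CountedStep p q ⊎ CountedStep q p
    earlier-collect-useful {p} {q} {a} {b} {sp} {sq} p≢q t₁≤a a<b b<t₂ step-a step-b q-coll p-coll none
      with <-cmp sq sp
    ... | tri< sq<sp _ _ =
      inj₁ (b , ≤-trans t₁≤a (<⇒≤ a<b) , b<t₂ , inj₁ (q , sq , sp , q-start-b , p-coll , sq<sp) , step-b)
      where
      q-start-b : CollectStartOf E q b sq
      q-start-b = CollectStartOf-collect step-b (InCollectAt-extend q-coll (<⇒≤ a<b) none)
    ... | tri≈ _ refl _ = ⊥-elim (p≢q (stepBy-functional (step-start p-coll) (step-start q-coll)))
      where
      step-start : ∀ {r i s} → InCollectAt E r i s → StepBy E r s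
      step-start (_ , _ , _ , (_ , _ , step-s , _)) = step-s
    ... | tri> _ _ sp<sq =
      inj₂ (a , t₁≤a , <-trans a<b b<t₂ , inj₁ (p , sp , sq , p-start-a p-coll , q-coll , sp<sq) , step-a)
      where
      p-start-a : InCollectAt E p b sp → CollectStartOf E p a sp
      p-start-a (j , (j<b , _ , between) , _ , start) =
        CollectStartOf-restrict start step-a (<⇒≤ (<-trans sp<sq (InCollectAt-start< q-coll)))
          (≮⇒≥ λ j<a → between a j<a a<b step-a)

    counted-step : ∀ {p q a b} → p ≢ q → t₁ ≤ a → a < b → b < t₂ →
      StepBy E p a → StepBy E q b → NoStepIn q t₁ b → CountedStep p q ⊎ CountedStep q p
    counted-step {p} {q} {a} {b} p≢q t₁≤a a<b b<t₂ step-a step-b none with phase q a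
    ... | inj₁ q-gap = inj₂ (last-step-extraneous p≢q t₁≤a a<b b<t₂ step-a step-b q-gap
                                     (NoStepIn-suffix t₁≤a none))
    ... | inj₂ (sq , q-coll) with phase p b
    ...   | inj₁ p-gap = inj₁ (first-step-extraneous p≢q t₁≤a a<b b<t₂ step-a step-b p-gap none)
    ...   | inj₂ (sp , p-coll) = earlier-collect-useful p≢q t₁≤a a<b b<t₂ step-a step-b q-coll p-coll
                                   (NoStepIn-suffix t₁≤a none)

    M-≥-counted-steps : ∀ {p k₁ k₂} → t₁ ≤ t₂ → M E p t₁ k₁ → M E p t₂ k₂ →
      (c : ∀ q → Maybe (CountedStep p q)) → k₁ + ∑[ q < n ] size (c q) ≤ k₂
    M-≥-counted-steps {p} {k₁} {k₂} t₁≤t₂ M₁ M₂ c =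
      subst (λ total → k₁ + total ≤ k₂) (sum-cong-≗ λ q → size-map proj₁ (c q))
        (Count-≥-witnesses M₁ M₂ t₁≤t₂ index inWindow distinct)
      where
      index : Fin n → Maybe ℕ
      index q = Maybe.map proj₁ (c q)
      inWindow : WitnessesIn (UsefulOrExtraneous E p) t₁ t₂ index
      inWindow q eq with map-proj₁-just (c q) eq
      ... | t₁≤i , i<t₂ , counted , _ = t₁≤i , i<t₂ , counted
      distinct : Distinct index
      distinct {q} {q′} eq eq′ with map-proj₁-just (c q) eq | map-proj₁-just (c q′) eq′
      ... | _ , _ , _ , q-step | _ , _ , _ , q′-step = stepBy-functional q-step q′-step

    first-active-step : ∀ {p} → Active E t₁ t₂ p →
      Σ ℕ λ a → t₁ ≤ a × a < t₂ × StepBy E p a × NoStepIn p t₁ a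
    first-active-step {p} (i , t₁≤i , i<t₂ , step-i)
      with least (λ k → t₁ ≤? k ×-dec stepBy? p k) (t₁≤i , step-i)
    ... | a , a≤i , (t₁≤a , step-a) , minimal =
      a , t₁≤a , ≤-<-trans a≤i i<t₂ , step-a , λ k t₁≤k k<a step-k → minimal k<a (t₁≤k , step-k)

    counted-step-between : ∀ {p q} → p ≢ q → Active E t₁ t₂ p → Active E t₁ t₂ q →
      CountedStep p q ⊎ CountedStep q p
    counted-step-between p≢q p-active q-active
      with first-active-step p-active | first-active-step q-active
    ... | a , t₁≤a , a<t₂ , step-a , first-a | b , t₁≤b , b<t₂ , step-b , first-b with <-cmp a b
    ... | tri< a<b _ _  = counted-step p≢q t₁≤a a<b b<t₂ step-a step-b first-b
    ... | tri≈ _ refl _ = ⊥-elim (p≢q (stepBy-functional step-a step-b))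
    ... | tri> _ _ b<a  = swap (counted-step (p≢q ∘ sym) t₁≤b b<a a<t₂ step-b step-a first-a)

lemma2 : ∀ (n : ℕ) (E : Execution n) → WellFormed E →
    ∀ (t₁ t₂ : ℕ) → t₁ ≤ t₂ →
    ∀ (m : ℕ) (S : Subset n) → (∀ p → (p ∈ S) ⇔ Active E t₁ t₂ p) → ∣ S ∣ ≡ m →
    ∀ (K₁ K₂ : Fin n → ℕ) →
    (∀ p → M E p t₁ (K₁ p)) → (∀ p → M E p t₂ (K₂ p)) →
    sum (map K₁ (allFin n)) + m C 2 ≤ sum (map K₂ (allFin n))
lemma2 n E _ t₁ t₂ t₁≤t₂ m S S⇔active refl K₁ K₂ M₁ M₂ = begin
  sum (map K₁ (allFin n)) + ∣ S ∣ C 2            ≡⟨ cong (_+ ∣ S ∣ C 2) (sum-map-allFin n K₁) ⟩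
  ∑[ p < n ] K₁ p + ∣ S ∣ C 2                    ≤⟨ +-monoʳ-≤ _ (∣S∣C2≤∑∑ S x covers) ⟩
  ∑[ p < n ] K₁ p + ∑[ p < n ] ∑[ q < n ] x p q  ≡⟨ sym (∑-distrib-+ K₁ _) ⟩
  ∑[ p < n ] (K₁ p + ∑[ q < n ] x p q)           ≤⟨ ∑-mono-≤ counted ⟩
  ∑[ p < n ] K₂ p                                ≡⟨ sym (sum-map-allFin n K₂) ⟩
  sum (map K₂ (allFin n))                        ∎
  where
  open ≤-Reasoning
  open Window E t₁ t₂
  active : ∀ {p} → p ∈ S → Active E t₁ t₂ p
  active {p} = Equivalence.to (S⇔active p)
  open Orientation CountedStep (λ p q → p ∈? S ×-dec q ∈? S ×-dec ¬? (p Fin.≟ q))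
    (λ (p∈S , q∈S , p≢q) → counted-step-between p≢q (active p∈S) (active q∈S))
  x : Fin n → Fin n → ℕ
  x p q = size (oriented p q)
  covers : Covers S x
  covers p q p∈S q∈S p≢q = oriented-covers (p∈S , q∈S , p≢q)
  counted : ∀ p → K₁ p + ∑[ q < n ] x p q ≤ K₂ p
  counted p = M-≥-counted-steps t₁≤t₂ (M₁ p) (M₂ p) (oriented p)
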